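{- In a strong labeling of a quadrangulation the following holds: if $v$ is a white (respectively black) vertex and $uv$ is an incoming edge at $v$, then the outgoing edge at $v$ with the same color as $uv$ is the next outgoing edge to the right (respectively left) of $uv$.
   Context: A quadrangulation is a plane graph that is a maximal bipartite plane graph; all faces, including the outer one, are bounded by 4-cycles. Its vertices are properly colored black and white. An angle is a corner of a face at a vertex; each edge has four incident angles (two at each endpoint, one on each side). A strong labeling of $Q$ is a map from angles to $\{0,1\}$ with: (G0) the two black outer vertices are named $s_0,s_1$ and all angles at $s_i$ are labeled $i$; (G1) for each $v\notin\{s_0,s_1\}$ the labels around $v$ form a non-empty interval of 1s and a non-empty interval of 0s; (G2) for each edge, the incident labels coincide at one endpoint and differ at the other; (G3$^+_Q$) labels in each bounded face are $0011$ cyclically, and labels of the outer face read clockwise from $s_0$ are $0011$. Each edge is colored with the label $i$ appearing twice at the endpoint where its labels coincide and oriented towards that endpoint; every vertex other than $s_0,s_1$ then has exactly one outgoing edge of each color. -}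

module Defs where

open import Data.Nat using (ℕ; zero; suc; _+_; _*_; _<_)
open import Data.Fin using (Fin; zero; suc)
open import Data.Product using (Σ; ∃; ∃-syntax; _×_; _,_)
open import Data.Sum using (_⊎_)
open import Relation.Binary.PropositionalEquality using (_≡_; _≢_)
open import Relation.Nullary using (¬_)
open import Function.Bundles using (_⇔_)

iter : ∀ {A : Set} → (A → A) → ℕ → A → A
iter f zero x = x
iter f (suc k) x = f (iter f k x)

SameOrbit : ∀ {A : Set} → (A → A) → A → A → Set
SameOrbit f x y = ∃[ k ] iter f k x ≡ y

data Reach {n : ℕ} (σ α : Fin n → Fin n) : Fin n → Fin n → Set where
  here  : ∀ {d} → Reach σ α d d
  stepσ : ∀ {d e} → Reach σ α (σ d) e → Reach σ α d e
  stepα : ∀ {d e} → Reach σ α (α d) e → Reach σ α d e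

data Colour : Set where
  black white : Colour

-- Conventions:
--  * α d   : the reverse dart of d (d goes from vtx d to vtx (α d)).
--  * σ d   : the next dart counterclockwise around the tail vertex of d;
--            σ⁻ is its inverse (next dart clockwise).
--  * Angles: the angle (corner) labelled by dart d is the corner at
--    vtx d lying between d and σ d (counterclockwise from d).
--  * φ d = α (σ d) : the next angle along the same face; faces are the
--    φ-orbits.  A bounded face is traversed clockwise by φ, the outer
--    face counterclockwise (as seen in the plane).

record PlaneMap (nD : ℕ) : Set where
  field
    α σ σ⁻  : Fin nD → Fin nD
    α-invol : ∀ d → α (α d) ≡ d
    α-nofix : ∀ d → α d ≢ d
    σσ⁻     : ∀ d → σ (σ⁻ d) ≡ d
    σ⁻σ     : ∀ d → σ⁻ (σ d) ≡ d
    nV nF   : ℕ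
    vtx     : Fin nD → Fin nV
    vtx-surj  : ∀ v → ∃[ d ] vtx d ≡ v
    vtx-orbit : ∀ d e → (vtx d ≡ vtx e) ⇔ SameOrbit σ d e
    fc      : Fin nD → Fin nF
    fc-surj   : ∀ f → ∃[ d ] fc d ≡ f
    fc-orbit  : ∀ d e → (fc d ≡ fc e) ⇔ SameOrbit (λ x → α (σ x)) d e
    connected : ∀ d e → Reach σ α d e
    -- Euler's formula V - E + F = 2, with E = nD / 2
    euler   : 2 * (nV + nF) ≡ nD + 4

  φ : Fin nD → Fin nD
  φ d = α (σ d)

-- Quadrangulations: simple bipartite plane maps all of whose faces
-- (including the outer one) are bounded by 4-cycles, with a proper
-- black/white vertex colouring and a designated outer face given by
-- an outer angle at a black vertex (s₀).

record Quadrangulation (nD : ℕ) : Set where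
  field
    pm : PlaneMap nD
  open PlaneMap pm public
  field
    colour     : Fin nV → Colour
    proper     : ∀ d → colour (vtx d) ≢ colour (vtx (α d))
    no-multi   : ∀ d e → vtx d ≡ vtx e → vtx (α d) ≡ vtx (α e) → d ≡ e
    face-len4  : ∀ d → iter φ 4 d ≡ d
    face-cycle : ∀ d → vtx d ≢ vtx (iter φ 2 d)
    outer      : Fin nD
    outer-black : colour (vtx outer) ≡ black

  s₀ s₁ : Fin nV
  s₀ = vtx outer
  s₁ = vtx (iter φ 2 outer)

module _ {nD : ℕ} (Q : Quadrangulation nD) where
  open Quadrangulation Q

  IntervalAt : (Fin nD → Fin 2) → Fin nV → Set
  IntervalAt lab v =
    ∃[ d ] vtx d ≡ v × ∃[ a ] ∃[ b ]
      ( iter σ (suc a + suc b) d ≡ d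
      × (∀ j → 0 < j → j < suc a + suc b → iter σ j d ≢ d)
      × (∀ j → j < suc a → lab (iter σ j d) ≡ suc zero)
      × (∀ j → j < suc b → lab (iter σ (suc a + j) d) ≡ zero))

  -- the two labels incident to the edge of d at its tail vtx d are
  -- the angles d and σ⁻ d; they coincide
  Coinc : (Fin nD → Fin 2) → Fin nD → Set
  Coinc lab d = lab d ≡ lab (σ⁻ d)

  Cyclic0011 : (Fin nD → Fin 2) → Fin nD → Set
  Cyclic0011 lab d = ∃[ k ]
      ( lab (iter φ k d) ≡ zero
      × lab (iter φ (1 + k) d) ≡ zero
      × lab (iter φ (2 + k) d) ≡ suc zero
      × lab (iter φ (3 + k) d) ≡ suc zero)

  record StrongLabeling : Set where
    field
      lab : Fin nD → Fin 2
      G0₀ : ∀ d → vtx d ≡ s₀ → lab d ≡ zero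
      G0₁ : ∀ d → vtx d ≡ s₁ → lab d ≡ suc zero
      G1  : ∀ v → v ≢ s₀ → v ≢ s₁ → IntervalAt lab v
      G2  : ∀ d → (Coinc lab d × ¬ Coinc lab (α d))
                ⊎ (¬ Coinc lab d × Coinc lab (α d))
      G3-inner : ∀ d → ¬ SameOrbit φ outer d → Cyclic0011 lab d
      -- (G3⁺_Q) outer face: read clockwise from s₀ the labels are 0011;
      -- φ runs counterclockwise around the outer face, so clockwise
      -- reading is outer, φ³ outer, φ² outer, φ outer.
      G3-outer : lab outer ≡ zero
               × lab (iter φ 3 outer) ≡ zero
               × lab (iter φ 2 outer) ≡ suc zero
               × lab (iter φ 1 outer) ≡ suc zero

  module _ (L : StrongLabeling) where
    open StrongLabeling L

    Out : Fin nD → Set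
    Out d = ¬ Coinc lab d

    outColour : Fin nD → Fin 2
    outColour d = lab (α d)

    -- For an incoming dart e (Coinc lab e, colour lab e) at v = vtx e,
    -- going around v with ρ (ρ = σ: counterclockwise = to the right
    -- when arriving at v along the edge; ρ = σ⁻: clockwise = left),
    -- the next outgoing edge is the outgoing edge of the same colour.
    NextOutSameColour : (Fin nD → Fin nD) → Fin nD → Set
    NextOutSameColour ρ e =
      ∀ k → 0 < k → Out (iter ρ k e)
          → (∀ j → 0 < j → j < k → ¬ Out (iter ρ j e))
          → outColour (iter ρ k e) ≡ lab e
          × (∀ f → vtx f ≡ vtx e → Out f → outColour f ≡ lab e
                 → f ≡ iter ρ k e)

-- The proof rests on a global parity invariant.  Call a corner x "agreeing"
-- when it carries the same label as the next corner φ x of its face.  The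
-- quantity  [x agrees] xor [vtx x is black]  is preserved by φ (a face reads
-- 0011, so opposite corners have different labels while the colours alternate),
-- by crossing an edge (this is exactly (G2)), hence by σ and α; the map is
-- connected and the quantity is true at the outer corner.  Thus white corners
-- agree and black corners do not.  Consequently the colour of an outgoing dart
-- is the label just before it at a white vertex and its own label at a black
-- vertex.  By (G1) the outgoing darts at an inner vertex are the first darts
-- of its 1-run and of its 0-run, so they are determined by their labels.
-- Finally, turning from an incoming dart towards the next outgoing one the
-- label does not change, which gives that dart the colour of the incoming one
-- (at a white vertex this holds even if the starting dart is not incoming).
module Submission where

open import Defs
open import Data.Bool using (Bool; true; false; not; _xor_)
open import Data.Bool.Properties
  using (not-involutive; xor-identityʳ; xor-annihilates-not; not-distribˡ-xor; not-distribʳ-xor)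
open import Data.Fin using (Fin; zero; suc; toℕ; fromℕ<)
open import Data.Fin.Properties using (any?; toℕ-fromℕ<) renaming (_≟_ to _≟ᶠ_)
open import Data.Nat using (ℕ; zero; suc; _+_; _*_; _<_; _≤_; s≤s; z<s; NonZero)
open import Data.Nat.DivMod using (_%_; _/_; m≡m%n+[m/n]*n; m%n<n)
open import Data.Nat.Properties
  using (_≟_; <-cmp; <⇒≤; m<n⇒m<1+n; n<1+n; ≤-refl; +-suc; +-identityʳ; +-cancelˡ-<; m≤n⇒∃[o]m+o≡n)
open import Data.Product using (∃; ∃-syntax; _×_; _,_)
open import Data.Sum using (_⊎_; inj₁; inj₂)
open import Function using (_∘_)
open import Function.Bundles using (Equivalence)
open import Relation.Binary.Definitions using (DecidableEquality; tri<; tri≈; tri>)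
open import Relation.Binary.PropositionalEquality
open import Relation.Nullary using (¬_; Dec; yes; no; contradiction)
open import Relation.Nullary.Decidable using (map′; decidable-stable)

open ≡-Reasoning

module _ {A : Set} (f : A → A) where

  iter-+ : ∀ m n x → iter f (m + n) x ≡ iter f m (iter f n x)
  iter-+ zero    n x = refl
  iter-+ (suc m) n x = cong f (iter-+ m n x)

  iter-commute : ∀ n x → iter f n (f x) ≡ f (iter f n x)
  iter-commute zero    x = refl
  iter-commute (suc n) x = cong f (iter-commute n x)

  iter-preserves : ∀ {B : Set} (h : A → B) → (∀ x → h (f x) ≡ h x) →
                   ∀ n x → h (iter f n x) ≡ h x
  iter-preserves h h-f zero    x = refl
  iter-preserves h h-f (suc n) x = trans (h-f _) (iter-preserves h h-f n x)

  iter-*-periodic : ∀ {p x} → iter f p x ≡ x → ∀ q → iter f (q * p) x ≡ x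
  iter-*-periodic         per zero    = refl
  iter-*-periodic {p} {x} per (suc q) = begin
    iter f (p + q * p) x      ≡⟨ iter-+ p (q * p) x ⟩
    iter f p (iter f (q * p) x) ≡⟨ cong (iter f p) (iter-*-periodic per q) ⟩
    iter f p x                ≡⟨ per ⟩
    x                         ∎

  iter-% : ∀ {p x} .{{_ : NonZero p}} → iter f p x ≡ x →
           ∀ m → iter f (m % p) x ≡ iter f m x
  iter-% {p} {x} per m = begin
    iter f (m % p) x                        ≡⟨ cong (iter f (m % p)) (iter-*-periodic per (m / p)) ⟨
    iter f (m % p) (iter f (m / p * p) x)   ≡⟨ iter-+ (m % p) (m / p * p) x ⟨
    iter f (m % p + m / p * p) x            ≡⟨ cong (λ n → iter f n x) (m≡m%n+[m/n]*n m p) ⟨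
    iter f m x                              ∎

  sameOrbit? : DecidableEquality A → ∀ p .{{_ : NonZero p}} → (∀ x → iter f p x ≡ x) →
               ∀ x y → Dec (SameOrbit f x y)
  sameOrbit? _≟ᴬ_ p per x y =
    map′ (λ (i , e) → toℕ i , e) within-period (any? λ i → iter f (toℕ i) x ≟ᴬ y)
    where
    within-period : SameOrbit f x y → ∃ λ (i : Fin p) → iter f (toℕ i) x ≡ y
    within-period (m , e) = fromℕ< (m%n<n m p) , (begin
      iter f (toℕ (fromℕ< (m%n<n m p))) x ≡⟨ cong (λ n → iter f n x) (toℕ-fromℕ< (m%n<n m p)) ⟩
      iter f (m % p) x                    ≡⟨ iter-% (per x) m ⟩
      iter f m x                          ≡⟨ e ⟩
      y                                   ∎)

flip : Fin 2 → Fin 2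
flip zero       = suc zero
flip (suc zero) = zero

agree : Fin 2 → Fin 2 → Bool
agree zero       zero       = true
agree zero       (suc zero) = false
agree (suc zero) zero       = false
agree (suc zero) (suc zero) = true

agree-comm : ∀ a b → agree a b ≡ agree b a
agree-comm zero       zero       = refl
agree-comm zero       (suc zero) = refl
agree-comm (suc zero) zero       = refl
agree-comm (suc zero) (suc zero) = refl

agree-flipˡ : ∀ a b → agree (flip a) b ≡ not (agree a b)
agree-flipˡ zero       zero       = refl
agree-flipˡ zero       (suc zero) = refl
agree-flipˡ (suc zero) zero       = refl
agree-flipˡ (suc zero) (suc zero) = refl

agree-flipʳ : ∀ a b → agree a (flip b) ≡ not (agree a b)
agree-flipʳ a b = trans (agree-comm a (flip b)) (trans (agree-flipˡ b a) (cong not (agree-comm b a)))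

agree⇒≡ : ∀ {a b} → agree a b ≡ true → a ≡ b
agree⇒≡ {zero}     {zero}     _  = refl
agree⇒≡ {zero}     {suc zero} ()
agree⇒≡ {suc zero} {zero}     ()
agree⇒≡ {suc zero} {suc zero} _  = refl

≢⇒≡flip : ∀ {a b : Fin 2} → a ≢ b → a ≡ flip b
≢⇒≡flip {zero}     {zero}     a≢b = contradiction refl a≢b
≢⇒≡flip {zero}     {suc zero} _   = refl
≢⇒≡flip {suc zero} {zero}     _   = refl
≢⇒≡flip {suc zero} {suc zero} a≢b = contradiction refl a≢b

-- p, d label the corners beside an edge at one end and c, c' those at the other,
-- with p and c on the same side; the hypothesis is (G2) for that edge.
agree-across-edge : ∀ {p d c c' : Fin 2} → (d ≡ p × c ≢ c') ⊎ (d ≢ p × c ≡ c') →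
                    agree p c ≡ not (agree c' d)
agree-across-edge {p} {_} {c} {c'} (inj₁ (refl , c≢c')) = begin
  agree p c                ≡⟨ agree-comm p c ⟩
  agree c p                ≡⟨ not-involutive _ ⟨
  not (not (agree c p))    ≡⟨ cong not (agree-flipˡ c p) ⟨
  not (agree (flip c) p)   ≡⟨ cong (λ x → not (agree x p)) (≢⇒≡flip (c≢c' ∘ sym)) ⟨
  not (agree c' p)         ∎
agree-across-edge {p} {d} {c} (inj₂ (d≢p , refl)) = begin
  agree p c                ≡⟨ agree-comm p c ⟩
  agree c p                ≡⟨ not-involutive _ ⟨
  not (not (agree c p))    ≡⟨ cong not (agree-flipʳ c p) ⟨
  not (agree c (flip p))   ≡⟨ cong (not ∘ agree c) (≢⇒≡flip d≢p) ⟨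
  not (agree c d)          ∎

isBlack : Colour → Bool
isBlack black = true
isBlack white = false

isBlack-≢ : ∀ {c c'} → c ≢ c' → isBlack c' ≡ not (isBlack c)
isBlack-≢ {black} {black} c≢c' = contradiction refl c≢c'
isBlack-≢ {black} {white} _    = refl
isBlack-≢ {white} {black} _    = refl
isBlack-≢ {white} {white} c≢c' = contradiction refl c≢c'

black-≢⇒white : ∀ {c} → black ≢ c → c ≡ white
black-≢⇒white {black} black≢c = contradiction refl black≢c
black-≢⇒white {white} _       = refl

-- g j is the label of the j-th corner around a vertex, as in (G1).
interval-step : ∀ (g : ℕ → Fin 2) a b →
                (∀ j → j < suc a → g j ≡ suc zero) →
                (∀ j → j < suc b → g (suc a + j) ≡ zero) →
                ∀ r → suc r < suc a + suc b → r ≢ a → g (suc r) ≡ g r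
interval-step g a b ones zeros r r<n r≢a with <-cmp r a
... | tri< r<a _ _ = trans (ones (suc r) (s≤s r<a)) (sym (ones r (m<n⇒m<1+n r<a)))
... | tri≈ _ r≡a _ = contradiction r≡a r≢a
... | tri> _ _ a<r with m≤n⇒∃[o]m+o≡n a<r
...   | j , refl = begin
  g (suc (suc a + j)) ≡⟨ cong g (+-suc (suc a) j) ⟨
  g (suc a + suc j)   ≡⟨ zeros (suc j) j<b ⟩
  zero                ≡⟨ zeros j (<⇒≤ j<b) ⟨
  g (suc a + j)       ∎
  where
  j<b : suc j < suc b
  j<b = +-cancelˡ-< (suc a) (suc j) (suc b) (subst (_< suc a + suc b) (sym (+-suc (suc a) j)) r<n)

module _ {nD : ℕ} (Q : Quadrangulation nD) (L : StrongLabeling Q) where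
  open Quadrangulation Q
  open StrongLabeling L
  open Equivalence using (to; from)

  vtx-σ : ∀ d → vtx (σ d) ≡ vtx d
  vtx-σ d = sym (from (vtx-orbit d (σ d)) (1 , refl))

  vtx-σ⁻ : ∀ d → vtx (σ⁻ d) ≡ vtx d
  vtx-σ⁻ d = from (vtx-orbit (σ⁻ d) d) (1 , σσ⁻ d)

  isBlack-α : ∀ d → isBlack (colour (vtx (α d))) ≡ not (isBlack (colour (vtx d)))
  isBlack-α d = isBlack-≢ (proper d)

  isBlack-φ : ∀ x → isBlack (colour (vtx (φ x))) ≡ not (isBlack (colour (vtx x)))
  isBlack-φ x = trans (isBlack-α (σ x)) (cong (not ∘ isBlack ∘ colour) (vtx-σ x))

  lab-φ⁴ : ∀ {i} n x → lab (iter φ (4 + n) x) ≡ i → lab (iter φ n x) ≡ i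
  lab-φ⁴ n x = trans (cong lab (sym (face-len4 (iter φ n x))))

  cyclic0011-φ : ∀ {d} → Cyclic0011 Q lab d → Cyclic0011 Q lab (φ d)
  cyclic0011-φ {d} (k , l₀ , l₁ , l₂ , l₃) =
    3 + k , shift k l₀ , shift (1 + k) l₁ , shift (2 + k) l₂ , shift (3 + k) l₃
    where
    shift : ∀ {i} n → lab (iter φ n d) ≡ i → lab (iter φ (3 + n) (φ d)) ≡ i
    shift n = trans (cong lab (trans (iter-commute φ (3 + n) d) (face-len4 (iter φ n d))))

  -- Along φ the outer face reads 0110 from outer, so its 0011 starts at φ³ outer.
  cyclic0011-outer : Cyclic0011 Q lab outer
  cyclic0011-outer with G3-outer
  ... | l₀ , l₃ , l₂ , l₁ =
    3 , l₃ , trans (cong lab (face-len4 outer)) l₀ ,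
    trans (cong lab (face-len4 (φ outer))) l₁ , trans (cong lab (face-len4 (φ (φ outer)))) l₂

  cyclic0011 : ∀ x → Cyclic0011 Q lab x
  cyclic0011 x with sameOrbit? φ _≟ᶠ_ 4 face-len4 outer x
  ... | yes (m , refl) = along-outer m
    where
    along-outer : ∀ m → Cyclic0011 Q lab (iter φ m outer)
    along-outer zero    = cyclic0011-outer
    along-outer (suc m) = cyclic0011-φ (along-outer m)
  ... | no outside = G3-inner x outside

  opposite-corner-of-0011 : ∀ k {x} →
    lab (iter φ k x) ≡ zero → lab (iter φ (1 + k) x) ≡ zero →
    lab (iter φ (2 + k) x) ≡ suc zero → lab (iter φ (3 + k) x) ≡ suc zero →
    lab (φ (φ x)) ≡ flip (lab x)
  opposite-corner-of-0011 0     l₀ _  l₂ _  rewrite l₀ = l₂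
  opposite-corner-of-0011 1 {x} _  l₁ _  l₃ rewrite lab-φ⁴ 0 x l₃ = l₁
  opposite-corner-of-0011 2 {x} l₀ _  l₂ _  rewrite lab-φ⁴ 0 x l₂ = l₀
  opposite-corner-of-0011 3 {x} _  l₁ _  l₃ rewrite lab-φ⁴ 0 x l₁ = lab-φ⁴ 2 x l₃
  opposite-corner-of-0011 (suc (suc (suc (suc k)))) {x} l₀ l₁ l₂ l₃ =
    opposite-corner-of-0011 k (lab-φ⁴ k x l₀) (lab-φ⁴ (1 + k) x l₁) (lab-φ⁴ (2 + k) x l₂) (lab-φ⁴ (3 + k) x l₃)

  opposite-corner : ∀ x → lab (φ (φ x)) ≡ flip (lab x)
  opposite-corner x with cyclic0011 x
  ... | k , l₀ , l₁ , l₂ , l₃ = opposite-corner-of-0011 k l₀ l₁ l₂ l₃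

  parity : Fin nD → Bool
  parity x = agree (lab x) (lab (φ x)) xor isBlack (colour (vtx x))

  parity-φ : ∀ x → parity (φ x) ≡ parity x
  parity-φ x = begin
    agree (lab (φ x)) (lab (φ (φ x))) xor isBlack (colour (vtx (φ x)))
      ≡⟨ cong₂ _xor_ (cong (agree (lab (φ x))) (opposite-corner x)) (isBlack-φ x) ⟩
    agree (lab (φ x)) (flip (lab x)) xor not b
      ≡⟨ cong (_xor not b) (trans (agree-flipʳ (lab (φ x)) (lab x)) (cong not (agree-comm (lab (φ x)) (lab x)))) ⟩
    not (agree (lab x) (lab (φ x))) xor not b
      ≡⟨ xor-annihilates-not (agree (lab x) (lab (φ x))) b ⟩
    parity x ∎
    where
    b = isBlack (colour (vtx x))

  parity-σ⁻ : ∀ d → parity (σ⁻ d) ≡ agree (lab (σ⁻ d)) (lab (α d)) xor isBlack (colour (vtx d))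
  parity-σ⁻ d = cong₂ _xor_ (cong (agree (lab (σ⁻ d)) ∘ lab ∘ α) (σσ⁻ d)) (cong (isBlack ∘ colour) (vtx-σ⁻ d))

  parity-across-edge : ∀ d → parity (σ⁻ d) ≡ parity (σ⁻ (α d))
  parity-across-edge d = begin
    parity (σ⁻ d)                                      ≡⟨ parity-σ⁻ d ⟩
    agree (lab (σ⁻ d)) (lab (α d)) xor b               ≡⟨ cong (_xor b) (agree-across-edge (G2 d)) ⟩
    not (agree (lab (σ⁻ (α d))) (lab d)) xor b         ≡⟨ not-distribˡ-xor (agree (lab (σ⁻ (α d))) (lab d)) b ⟨
    not (agree (lab (σ⁻ (α d))) (lab d) xor b)         ≡⟨ not-distribʳ-xor (agree (lab (σ⁻ (α d))) (lab d)) b ⟩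
    agree (lab (σ⁻ (α d))) (lab d) xor not b
      ≡⟨ cong₂ _xor_ (cong (agree (lab (σ⁻ (α d))) ∘ lab) (sym (α-invol d))) (sym (isBlack-α d)) ⟩
    agree (lab (σ⁻ (α d))) (lab (α (α d))) xor isBlack (colour (vtx (α d))) ≡⟨ parity-σ⁻ (α d) ⟨
    parity (σ⁻ (α d))                                  ∎
    where
    b = isBlack (colour (vtx d))

  parity-α : ∀ d → parity (α d) ≡ parity d
  parity-α d = begin
    parity (α d)             ≡⟨ cong (parity ∘ α) (σσ⁻ d) ⟨
    parity (φ (σ⁻ d))        ≡⟨ parity-φ (σ⁻ d) ⟩
    parity (σ⁻ d)            ≡⟨ parity-across-edge d ⟩
    parity (σ⁻ (α d))        ≡⟨ parity-φ (σ⁻ (α d)) ⟨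
    parity (φ (σ⁻ (α d)))    ≡⟨ cong parity (trans (cong α (σσ⁻ (α d))) (α-invol d)) ⟩
    parity d                 ∎

  parity-σ : ∀ d → parity (σ d) ≡ parity d
  parity-σ d = begin
    parity (σ d)         ≡⟨ cong parity (α-invol (σ d)) ⟨
    parity (α (φ d))     ≡⟨ parity-α (φ d) ⟩
    parity (φ d)         ≡⟨ parity-φ d ⟩
    parity d             ∎

  parity-reach : ∀ {d e} → Reach σ α d e → parity e ≡ parity d
  parity-reach here      = refl
  parity-reach (stepσ r) = trans (parity-reach r) (parity-σ _)
  parity-reach (stepα r) = trans (parity-reach r) (parity-α _)

  parity-outer : parity outer ≡ true
  parity-outer with G3-outer
  ... | l₀ , _ , _ , l₁ rewrite l₀ | l₁ | outer-black = refl

  parity-true : ∀ x → parity x ≡ true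
  parity-true x = trans (parity-reach (connected outer x)) parity-outer

  white-corner-agrees : ∀ x → colour (vtx x) ≡ white → lab (φ x) ≡ lab x
  white-corner-agrees x w = sym (agree⇒≡ (begin
    agree (lab x) (lab (φ x))                                      ≡⟨ xor-identityʳ _ ⟨
    agree (lab x) (lab (φ x)) xor false                            ≡⟨ cong (λ c → agree (lab x) (lab (φ x)) xor isBlack c) w ⟨
    parity x                                                       ≡⟨ parity-true x ⟩
    true                                                           ∎))

  outColour-white : ∀ d → colour (vtx d) ≡ white → outColour Q L d ≡ lab (σ⁻ d)
  outColour-white d w = begin
    lab (α d)           ≡⟨ cong (lab ∘ α) (σσ⁻ d) ⟨
    lab (φ (σ⁻ d))      ≡⟨ white-corner-agrees (σ⁻ d) (trans (cong colour (vtx-σ⁻ d)) w) ⟩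
    lab (σ⁻ d)          ∎

  outColour-black : ∀ d → colour (vtx d) ≡ black → Out Q L d → outColour Q L d ≡ lab d
  outColour-black d b out with G2 d
  ... | inj₁ (coinc , _)   = contradiction coinc out
  ... | inj₂ (_ , coinc-α) = begin
    lab (α d)           ≡⟨ coinc-α ⟩
    lab (σ⁻ (α d))      ≡⟨ outColour-white (α d) (black-≢⇒white (subst (_≢ colour (vtx (α d))) b (proper d))) ⟨
    lab (α (α d))       ≡⟨ cong lab (α-invol d) ⟩
    lab d               ∎

  outgoing-by-label : ∀ v → v ≢ s₀ → v ≢ s₁ →
    ∃[ start ] ∀ f → vtx f ≡ v → Out Q L f → f ≡ start (lab f)
  outgoing-by-label v v≢s₀ v≢s₁ with G1 v v≢s₀ v≢s₁
  ... | d₀ , vd₀ , a , b , period , _ , ones , zeros = start , outgoing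
    where
    start : Fin 2 → Fin nD
    start zero       = iter σ (suc a) d₀
    start (suc zero) = d₀

    at-position : ∀ r → r < suc a + suc b → Out Q L (iter σ r d₀) →
                  iter σ r d₀ ≡ start (lab (iter σ r d₀))
    at-position zero    _   _   = sym (cong start (ones 0 z<s))
    at-position (suc r) r<n out with r ≟ a
    ... | yes refl = sym (cong start (trans (cong (λ n → lab (iter σ n d₀)) (sym (+-identityʳ (suc a))))
                                            (zeros 0 z<s)))
    ... | no r≢a   = contradiction
      (trans (interval-step (λ j → lab (iter σ j d₀)) a b ones zeros r r<n r≢a)
             (cong lab (sym (σ⁻σ (iter σ r d₀)))))
      out

    outgoing : ∀ f → vtx f ≡ v → Out Q L f → f ≡ start (lab f)
    outgoing f vf out with to (vtx-orbit d₀ f) (trans vd₀ (sym vf))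
    ... | m , σᵐd₀≡f = subst (λ y → y ≡ start (lab y)) reduced
        (at-position (m % (suc a + suc b)) (m%n<n m (suc a + suc b)) (subst (Out Q L) (sym reduced) out))
      where
      reduced : iter σ (m % (suc a + suc b)) d₀ ≡ f
      reduced = trans (iter-% σ period m) σᵐd₀≡f

  outColour-injective : ∀ {f g} → vtx f ≡ vtx g → vtx g ≢ s₀ → vtx g ≢ s₁ →
    Out Q L f → Out Q L g → outColour Q L f ≡ outColour Q L g → f ≡ g
  outColour-injective {f} {g} vf≡vg g≢s₀ g≢s₁ out-f out-g same-colour
    with outgoing-by-label (vtx g) g≢s₀ g≢s₁
  ... | start , outgoing =
    trans (outgoing f vf≡vg out-f) (trans (cong start same-label) (sym (outgoing g refl out-g)))
    where
    same-label : lab f ≡ lab g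
    same-label with colour (vtx g) in g-colour
    ... | white = begin
      lab f                      ≡⟨ ≢⇒≡flip out-f ⟩
      flip (lab (σ⁻ f))          ≡⟨ cong flip (outColour-white f (trans (cong colour vf≡vg) g-colour)) ⟨
      flip (outColour Q L f)     ≡⟨ cong flip same-colour ⟩
      flip (outColour Q L g)     ≡⟨ cong flip (outColour-white g g-colour) ⟩
      flip (lab (σ⁻ g))          ≡⟨ ≢⇒≡flip out-g ⟨
      lab g                      ∎
    ... | black = begin
      lab f                      ≡⟨ outColour-black f (trans (cong colour vf≡vg) g-colour) out-f ⟨
      outColour Q L f            ≡⟨ same-colour ⟩
      outColour Q L g            ≡⟨ outColour-black g g-colour out-g ⟩
      lab g                      ∎

  coinc-of-¬Out : ∀ {x} → ¬ Out Q L x → Coinc Q lab x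
  coinc-of-¬Out = decidable-stable (_ ≟ᶠ _)

  NoOutBefore : (Fin nD → Fin nD) → Fin nD → ℕ → Set
  NoOutBefore ρ e k = ∀ j → 0 < j → j < k → ¬ Out Q L (iter ρ j e)

  lab-along-σ : ∀ {e k} → NoOutBefore σ e k → ∀ j → j < k → lab (iter σ j e) ≡ lab e
  lab-along-σ         no-out zero    _   = refl
  lab-along-σ {e} no-out (suc j) j<k = begin
    lab (σ (iter σ j e))         ≡⟨ coinc-of-¬Out (no-out (suc j) z<s j<k) ⟩
    lab (σ⁻ (σ (iter σ j e)))    ≡⟨ cong lab (σ⁻σ (iter σ j e)) ⟩
    lab (iter σ j e)             ≡⟨ lab-along-σ no-out j (<⇒≤ j<k) ⟩
    lab e                        ∎

  lab-along-σ⁻ : ∀ {e k} → Coinc Q lab e → NoOutBefore σ⁻ e k →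
                 ∀ j → j ≤ k → lab (iter σ⁻ j e) ≡ lab e
  lab-along-σ⁻             coinc no-out zero    _   = refl
  lab-along-σ⁻ {e} {k} coinc no-out (suc j) j<k =
    trans (sym (coinc-at j j<k)) (lab-along-σ⁻ coinc no-out j (<⇒≤ j<k))
    where
    coinc-at : ∀ i → i < k → Coinc Q lab (iter σ⁻ i e)
    coinc-at zero    _   = coinc
    coinc-at (suc i) i<k = coinc-of-¬Out (no-out (suc i) z<s i<k)

  NextOutHasColour : (Fin nD → Fin nD) → Fin nD → Set
  NextOutHasColour ρ e = ∀ k → 0 < k → Out Q L (iter ρ k e) → NoOutBefore ρ e k →
                         outColour Q L (iter ρ k e) ≡ lab e

  nextOut-of-colour : ∀ {ρ e} → (∀ d → vtx (ρ d) ≡ vtx d) → vtx e ≢ s₀ → vtx e ≢ s₁ →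
                      NextOutHasColour ρ e → NextOutSameColour Q L ρ e
  nextOut-of-colour {ρ} {e} vtx-ρ e≢s₀ e≢s₁ has-colour k 0<k out no-out =
    colourₖ , λ f vf out-f colour-f →
      outColour-injective (trans vf (sym vtxₖ)) (e≢s₀ ∘ trans (sym vtxₖ)) (e≢s₁ ∘ trans (sym vtxₖ))
                          out-f out (trans colour-f (sym colourₖ))
    where
    colourₖ = has-colour k 0<k out no-out
    vtxₖ : vtx (iter ρ k e) ≡ vtx e
    vtxₖ = iter-preserves ρ vtx vtx-ρ k e

  nextOut-white : ∀ {e} → colour (vtx e) ≡ white → vtx e ≢ s₀ → vtx e ≢ s₁ →
                  NextOutSameColour Q L σ e
  nextOut-white {e} w e≢s₀ e≢s₁ = nextOut-of-colour vtx-σ e≢s₀ e≢s₁ has-colour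
    where
    has-colour : NextOutHasColour σ e
    has-colour (suc k) _ _ no-out = begin
      outColour Q L (σ (iter σ k e))
        ≡⟨ outColour-white _ (trans (cong colour (iter-preserves σ vtx vtx-σ (suc k) e)) w) ⟩
      lab (σ⁻ (σ (iter σ k e)))     ≡⟨ cong lab (σ⁻σ (iter σ k e)) ⟩
      lab (iter σ k e)              ≡⟨ lab-along-σ no-out k (n<1+n k) ⟩
      lab e                         ∎

  nextOut-black : ∀ {e} → Coinc Q lab e → colour (vtx e) ≡ black → vtx e ≢ s₀ → vtx e ≢ s₁ →
                  NextOutSameColour Q L σ⁻ e
  nextOut-black {e} coinc b e≢s₀ e≢s₁ = nextOut-of-colour vtx-σ⁻ e≢s₀ e≢s₁ has-colour
    where
    has-colour : NextOutHasColour σ⁻ e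
    has-colour k _ out no-out =
      trans (outColour-black _ (trans (cong colour (iter-preserves σ⁻ vtx vtx-σ⁻ k e)) b) out)
            (lab-along-σ⁻ coinc no-out k ≤-refl)

lemma3 : ∀ {nD : ℕ} (Q : Quadrangulation nD) (L : StrongLabeling Q)
           (e : Fin nD) →
           Quadrangulation.vtx Q e ≢ Quadrangulation.s₀ Q →
           Quadrangulation.vtx Q e ≢ Quadrangulation.s₁ Q →
           Coinc Q (StrongLabeling.lab L) e →
           (Quadrangulation.colour Q (Quadrangulation.vtx Q e) ≡ white →
             NextOutSameColour Q L (Quadrangulation.σ Q) e)
           × (Quadrangulation.colour Q (Quadrangulation.vtx Q e) ≡ black →
             NextOutSameColour Q L (Quadrangulation.σ⁻ Q) e)
lemma3 Q L e e≢s₀ e≢s₁ coinc =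
  (λ w → nextOut-white Q L w e≢s₀ e≢s₁) , (λ b → nextOut-black Q L coinc b e≢s₀ e≢s₁)
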